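{- Let $k$ be a positive integer. Then there exists a graph $G$ with $\chi_c(G)=\frac{9k+3}{3k+2}$ such that $G$ contains no subgraph whose circular chromatic number equals $\frac{6k+1}{2k+1}$.
   Context: For positive integers $n\ge 2d$, the circular complete graph $K_{n/d}$ has vertex set $\{0,\dots,n-1\}$ with $ij$ an edge iff $d\le|i-j|\le n-d$. The circular chromatic number of a graph $G$ is $\chi_c(G)=\inf\{\frac nd : \text{there is a homomorphism } G\to K_{n/d}\}$. -}

module Defs where

open import Level using (0ℓ)
open import Data.Nat using (ℕ; _+_; _*_; _∸_; _≤_; _<_; ∣_-_∣)
open import Data.Fin using (Fin; toℕ)
open import Data.Product using (Σ; ∃; _×_)
open import Relation.Binary.PropositionalEquality using (_≡_)
open import Relation.Nullary using (¬_)
open import Function.Definitions using (Injective)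

record Graph : Set₁ where
  field
    size : ℕ
    Adj  : Fin size → Fin size → Set
    sym  : ∀ {u v} → Adj u v → Adj v u
    irr  : ∀ {u} → ¬ Adj u u
open Graph public

CircAdj : (n d : ℕ) → Fin n → Fin n → Set
CircAdj n d i j = d ≤ ∣ toℕ i - toℕ j ∣ × ∣ toℕ i - toℕ j ∣ ≤ n ∸ d

CircHom : Graph → (n d : ℕ) → Set
CircHom G n d = Σ (Fin (size G) → Fin n) λ c →
  ∀ u v → Adj G u v → CircAdj n d (c u) (c v)

Admissible : ℕ → ℕ → Set
Admissible n d = 1 ≤ d × d + d ≤ n

-- χ_c(G) = a/b (b > 0), i.e. a/b is the infimum of
-- { n/d : n,d admissible and G → K_{n/d} }:
--  (i)  a/b is a lower bound:  a/b ≤ n/d  for every such (n,d);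
--  (ii) it is the greatest one: for every rational s/t > a/b there is
--       such (n,d) with n/d < s/t.
-- (fractions compared by cross multiplication)
χc≡ : Graph → (a b : ℕ) → Set
χc≡ G a b =
  (∀ n d → Admissible n d → CircHom G n d → a * d ≤ n * b) ×
  (∀ s t → 1 ≤ t → a * t < s * b →
     ∃ λ n → ∃ λ d → Admissible n d × CircHom G n d × n * t < s * d)

SubgraphOf : Graph → Graph → Set
SubgraphOf H G = Σ (Fin (size H) → Fin (size G)) λ f →
  Injective _≡_ _≡_ f × (∀ u v → Adj H u v → Adj G (f u) (f v))

-- The graph is K_m (m = 3k + 1) with every edge replaced by a path of length 3. Along each edge a
-- colouring into K_{n/d} moves clockwise by an amount in [d, n − d], so going along a path the
-- colours of two branch vertices end up at least 3d − n apart in both directions around the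
-- cycle; packing m such points on a cycle of length n gives χ_c ≥ 3m/(m+1), and an explicit
-- colouring attains it. Deleting any edge leaves a graph that maps to the same graph for m − 1,
-- hence to K_{3(m−1)/m}. As 3(m−1)/m < (6k+1)/(2k+1) < 3m/(m+1), a subgraph H with
-- χ_c(H) = (6k+1)/(2k+1) would have to contain every edge; but then every colouring of H
-- colours the whole graph, so χ_c(H) = 3m/(m+1).
module Submission where

open import Defs hiding (sym)
open import Data.Nat
  using (ℕ; zero; suc; _+_; _*_; _∸_; _≤_; _<_; z≤n; s≤s; z<s; _≤?_; NonZero; >-nonZero; _%_; _/_; ∣_-_∣)
open import Data.Nat.Properties hiding (_≟_)
open import Data.Nat.DivMod
open import Data.Nat.Tactic.RingSolver using (solve-∀)
open import Data.Fin as Fin using (Fin; toℕ; fromℕ<)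
open import Data.Fin.Properties
  using (_≟_; toℕ<n; toℕ-fromℕ<; fromℕ<-cong; fromℕ<-toℕ; injective⇒≤; any?;
         remQuot-combine; combine-remQuot; punchInᵢ≢i; punchOut-cong; punchOut-injective)
open import Data.Product using (Σ; ∃; ∃₂; _×_; _,_; proj₁; proj₂; uncurry)
open import Data.Sum using (_⊎_; inj₁; inj₂) renaming (swap to ⊎-swap)
open import Function using (_∘_)
open import Function.Definitions using (Injective)
open import Relation.Nullary using (¬_; Dec; yes; no; contradiction)
open import Relation.Nullary.Decidable using (_×-dec_; decidable-stable; toSum)
open import Relation.Binary.PropositionalEquality
  using (_≡_; _≢_; refl; sym; ≢-sym; trans; cong; cong₂; subst; subst₂; module ≡-Reasoning)

[m+n%o]%o≡[m+n]%o : ∀ m n o .{{_ : NonZero o}} → (m + n % o) % o ≡ (m + n) % o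
[m+n%o]%o≡[m+n]%o m n o = begin
  (m + n % o) % o          ≡⟨ %-distribˡ-+ m (n % o) o ⟩
  (m % o + n % o % o) % o  ≡⟨ cong (λ x → (m % o + x) % o) (m%n%n≡m%n n o) ⟩
  (m % o + n % o) % o      ≡⟨ %-distribˡ-+ m n o ⟨
  (m + n) % o              ∎
  where open ≡-Reasoning

m<n+n⇒m≡m%n⊎m≡m%n+n : ∀ {m n} .{{_ : NonZero n}} → m < n + n → m ≡ m % n ⊎ m ≡ m % n + n
m<n+n⇒m≡m%n⊎m≡m%n+n {m} {n} m<n+n with m / n | m≡m%n+[m/n]*n m n | m<n*o⇒m/o<n {m} {2} m<2*n
  where
  m<2*n : m < 2 * n
  m<2*n = subst (m <_) (cong (n +_) (sym (+-identityʳ n))) m<n+n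
... | 0           | m≡ | _ = inj₁ (trans m≡ (+-identityʳ _))
... | 1           | m≡ | _ = inj₂ (trans m≡ (cong (m % n +_) (+-identityʳ n)))
... | suc (suc _) | _  | s≤s (s≤s ())

module _ {n : ℕ} .{{_ : NonZero n}} where

  [_] : ℕ → Fin n
  [ m ] = fromℕ< (m%n<n m n)

  []-cong : ∀ {m o} → m % n ≡ o % n → [ m ] ≡ [ o ]
  []-cong {m} {o} eq = fromℕ<-cong (m % n) (o % n) eq _ _

  [toℕ-u]≡u : ∀ (u : Fin n) → [ toℕ u ] ≡ u
  [toℕ-u]≡u u = trans (fromℕ<-cong _ _ (m<n⇒m%n≡m (toℕ<n u)) _ (toℕ<n u)) (fromℕ<-toℕ u (toℕ<n u))

  [m+n]≡[m] : ∀ m → [ m + n ] ≡ [ m ]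
  [m+n]≡[m] m = []-cong ([m+n]%n≡m%n m n)

  infixl 6 _⊕_
  _⊕_ : Fin n → ℕ → Fin n
  u ⊕ f = [ toℕ u + f ]

  [m]⊕f≡[m+f] : ∀ m f → [ m ] ⊕ f ≡ [ m + f ]
  [m]⊕f≡[m+f] m f = []-cong (begin
    (toℕ [ m ] + f) % n  ≡⟨ cong (λ x → (x + f) % n) (toℕ-fromℕ< (m%n<n m n)) ⟩
    (m % n + f) % n      ≡⟨ cong (_% n) (+-comm (m % n) f) ⟩
    (f + m % n) % n      ≡⟨ [m+n%o]%o≡[m+n]%o f m n ⟩
    (f + m) % n          ≡⟨ cong (_% n) (+-comm f m) ⟩
    (m + f) % n          ∎)
    where open ≡-Reasoning

  ⊕-assoc : ∀ u f g → u ⊕ f ⊕ g ≡ u ⊕ (f + g)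
  ⊕-assoc u f g = trans ([m]⊕f≡[m+f] (toℕ u + f) g) (cong [_] (+-assoc (toℕ u) f g))

  ⊕-identityʳ : ∀ u → u ⊕ 0 ≡ u
  ⊕-identityʳ u = trans (cong [_] (+-identityʳ (toℕ u))) ([toℕ-u]≡u u)

  -- The clockwise distance from u to v; opaque, so that Agda can recover u and v from cw u v.
  opaque
    cw : Fin n → Fin n → ℕ
    cw u v = (n ∸ toℕ u + toℕ v) % n

    cw<n : ∀ u v → cw u v < n
    cw<n u v = m%n<n _ n

    ⊕-cw : ∀ u v → u ⊕ cw u v ≡ v
    ⊕-cw u v = begin
      [ toℕ u + (n ∸ toℕ u + toℕ v) % n ]  ≡⟨ []-cong ([m+n%o]%o≡[m+n]%o (toℕ u) _ n) ⟩
      [ toℕ u + (n ∸ toℕ u + toℕ v) ]      ≡⟨ cong [_] (sym (+-assoc (toℕ u) _ (toℕ v))) ⟩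
      [ toℕ u + (n ∸ toℕ u) + toℕ v ]      ≡⟨ cong (λ x → [ x + toℕ v ]) (m+[n∸m]≡n (<⇒≤ (toℕ<n u))) ⟩
      [ n + toℕ v ]                        ≡⟨ cong [_] (+-comm n (toℕ v)) ⟩
      [ toℕ v + n ]                        ≡⟨ [m+n]≡[m] (toℕ v) ⟩
      [ toℕ v ]                            ≡⟨ [toℕ-u]≡u v ⟩
      v                                    ∎
      where open ≡-Reasoning

    cw-⊕ : ∀ {u v} f → u ⊕ f ≡ v → cw u v ≡ f % n
    cw-⊕ {u} f refl = begin
      (n ∸ toℕ u + toℕ [ toℕ u + f ]) % n  ≡⟨ cong (λ x → (n ∸ toℕ u + x) % n) (toℕ-fromℕ< (m%n<n _ n)) ⟩
      (n ∸ toℕ u + (toℕ u + f) % n) % n    ≡⟨ [m+n%o]%o≡[m+n]%o (n ∸ toℕ u) _ n ⟩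
      (n ∸ toℕ u + (toℕ u + f)) % n        ≡⟨ cong (_% n) (sym (+-assoc (n ∸ toℕ u) (toℕ u) f)) ⟩
      (n ∸ toℕ u + toℕ u + f) % n          ≡⟨ cong (λ x → (x + f) % n) (m∸n+n≡m (<⇒≤ (toℕ<n u))) ⟩
      (n + f) % n                          ≡⟨ cong (_% n) (+-comm n f) ⟩
      (f + n) % n                          ≡⟨ [m+n]%n≡m%n f n ⟩
      f % n                                ∎
      where open ≡-Reasoning

    cw-self : ∀ u → cw u u ≡ 0
    cw-self u = trans (cong (_% n) (m∸n+n≡m (<⇒≤ (toℕ<n u)))) (n%n≡0 n)

  cw-⊕-< : ∀ {u v f} → f < n → u ⊕ f ≡ v → cw u v ≡ f
  cw-⊕-< {f = f} f<n u⊕f≡v = trans (cw-⊕ f u⊕f≡v) (m<n⇒m%n≡m f<n)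

  cw≡0⇒≡ : ∀ {u v} → cw u v ≡ 0 → u ≡ v
  cw≡0⇒≡ {u} {v} eq = trans (sym (⊕-identityʳ u)) (trans (cong (u ⊕_) (sym eq)) (⊕-cw u v))

  cw-+ : ∀ u v w → cw u v + cw v w ≡ cw u w ⊎ cw u v + cw v w ≡ cw u w + n
  cw-+ u v w = subst (λ r → X ≡ r ⊎ X ≡ r + n) (sym (cw-⊕ X u⊕X≡w)) (m<n+n⇒m≡m%n⊎m≡m%n+n X<n+n)
    where
    open ≡-Reasoning
    X : ℕ
    X = cw u v + cw v w
    X<n+n : X < n + n
    X<n+n = +-mono-< (cw<n u v) (cw<n v w)
    u⊕X≡w : u ⊕ X ≡ w
    u⊕X≡w = begin
      u ⊕ X                ≡⟨ ⊕-assoc u (cw u v) (cw v w) ⟨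
      u ⊕ cw u v ⊕ cw v w  ≡⟨ cong (_⊕ cw v w) (⊕-cw u v) ⟩
      v ⊕ cw v w           ≡⟨ ⊕-cw v w ⟩
      w                    ∎

  cw+cw≡n : ∀ {u v} → u ≢ v → cw u v + cw v u ≡ n
  cw+cw≡n {u} {v} u≢v with cw-+ u v u
  ... | inj₂ eq = trans eq (cong (_+ n) (cw-self u))
  ... | inj₁ eq = contradiction (cw≡0⇒≡ (m+n≡0⇒m≡0 (cw u v) (trans eq (cw-self u)))) u≢v

[k*[m%n]]≡[k*m] : ∀ {n} k m .{{_ : NonZero n}} .{{_ : NonZero (k * n)}} →
  _≡_ {A = Fin (k * n)} [ k * (m % n) ] [ k * m ]
[k*[m%n]]≡[k*m] {n} k m = []-cong (sym (begin
  (k * m) % (k * n)                          ≡⟨ cong (λ x → (k * x) % (k * n)) (m≡m%n+[m/n]*n m n) ⟩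
  (k * (m % n + m / n * n)) % (k * n)        ≡⟨ cong (_% (k * n)) (distrib k (m % n) (m / n) n) ⟩
  (k * (m % n) + m / n * (k * n)) % (k * n)  ≡⟨ [m+kn]%n≡m%n (k * (m % n)) (m / n) (k * n) ⟩
  (k * (m % n)) % (k * n)                    ∎))
  where
  open ≡-Reasoning
  distrib : ∀ k r q n → k * (r + q * n) ≡ k * r + q * (k * n)
  distrib = solve-∀

Arc : ℕ → ℕ → ℕ → Set
Arc n d f = d ≤ f × f ≤ n ∸ d

Arc-complement : ∀ {n d x y} → x + y ≡ n → d ≤ n → Arc n d x → Arc n d y
Arc-complement {n} {d} {x} {y} x+y≡n d≤n (d≤x , x≤n∸d) =
  +-cancelˡ-≤ x d y (subst (x + d ≤_) (sym x+y≡n) (m≤o∸n⇒m+n≤o x d≤n x≤n∸d)) ,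
  m+n≤o⇒m≤o∸n y (subst (y + d ≤_) (trans (+-comm y x) x+y≡n) (+-monoʳ-≤ y d≤x))

Arc⇒+≤ : ∀ {n d f} → d ≤ n → Arc n d f → f + d ≤ n
Arc⇒+≤ {f = f} d≤n (_ , f≤n∸d) = m≤o∸n⇒m+n≤o f d≤n f≤n∸d

module _ {n : ℕ} .{{_ : NonZero n}} where

  ∣-∣≡cw⊎∣-∣+cw≡n : ∀ (u v : Fin n) →
    ∣ toℕ u - toℕ v ∣ ≡ cw u v ⊎ ∣ toℕ u - toℕ v ∣ + cw u v ≡ n
  ∣-∣≡cw⊎∣-∣+cw≡n u v with toℕ u ≤? toℕ v
  ... | yes u≤v = inj₁ (trans (m≤n⇒∣m-n∣≡n∸m u≤v) (sym (cw-⊕-< δ<n u⊕δ≡v)))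
    where
    δ : ℕ
    δ = toℕ v ∸ toℕ u
    δ<n : δ < n
    δ<n = ≤-<-trans (m∸n≤m (toℕ v) (toℕ u)) (toℕ<n v)
    u⊕δ≡v : u ⊕ δ ≡ v
    u⊕δ≡v = trans (cong [_] (m+[n∸m]≡n u≤v)) ([toℕ-u]≡u v)
  ... | no u≰v = inj₂ (begin
    ∣ toℕ u - toℕ v ∣ + cw u v  ≡⟨ cong₂ _+_ (m≤n⇒∣n-m∣≡n∸m v≤u) (cw-⊕-< n∸δ<n u⊕[n∸δ]≡v) ⟩
    δ + (n ∸ δ)                 ≡⟨ m+[n∸m]≡n δ≤n ⟩
    n                           ∎)
    where
    open ≡-Reasoning
    v≤u : toℕ v ≤ toℕ u
    v≤u = <⇒≤ (≰⇒> u≰v)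
    δ : ℕ
    δ = toℕ u ∸ toℕ v
    δ≤n : δ ≤ n
    δ≤n = ≤-trans (m∸n≤m (toℕ u) (toℕ v)) (<⇒≤ (toℕ<n u))
    n∸δ<n : n ∸ δ < n
    n∸δ<n = ∸-monoʳ-< (m<n⇒0<n∸m (≰⇒> u≰v)) δ≤n
    u⊕[n∸δ]≡v : u ⊕ (n ∸ δ) ≡ v
    u⊕[n∸δ]≡v = begin
      [ toℕ u + (n ∸ δ) ]        ≡⟨ cong (λ x → [ x + (n ∸ δ) ]) (m+[n∸m]≡n v≤u) ⟨
      [ toℕ v + δ + (n ∸ δ) ]    ≡⟨ cong [_] (+-assoc (toℕ v) δ (n ∸ δ)) ⟩
      [ toℕ v + (δ + (n ∸ δ)) ]  ≡⟨ cong (λ x → [ toℕ v + x ]) (m+[n∸m]≡n δ≤n) ⟩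
      [ toℕ v + n ]              ≡⟨ [m+n]≡[m] (toℕ v) ⟩
      [ toℕ v ]                  ≡⟨ [toℕ-u]≡u v ⟩
      v                          ∎

  CircAdj⇒Arc-cw : ∀ {d} {u v : Fin n} → d ≤ n → CircAdj n d u v → Arc n d (cw u v)
  CircAdj⇒Arc-cw {u = u} {v} d≤n adj with ∣-∣≡cw⊎∣-∣+cw≡n u v
  ... | inj₁ eq = subst (Arc n _) eq adj
  ... | inj₂ eq = Arc-complement eq d≤n adj

  Arc-cw⇒CircAdj : ∀ {d} {u v : Fin n} → d ≤ n → Arc n d (cw u v) → CircAdj n d u v
  Arc-cw⇒CircAdj {u = u} {v} d≤n arc with ∣-∣≡cw⊎∣-∣+cw≡n u v
  ... | inj₁ eq = subst (Arc n _) (sym eq) arc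
  ... | inj₂ eq = Arc-complement (trans (+-comm (cw u v) _) eq) d≤n arc

  ⊕-Arc⇒CircAdj : ∀ {d f} {u v : Fin n} → 1 ≤ d → d ≤ n → Arc n d f → u ⊕ f ≡ v → CircAdj n d u v
  ⊕-Arc⇒CircAdj {d} {f} 1≤d d≤n arc u⊕f≡v = Arc-cw⇒CircAdj d≤n (subst (Arc n d) (sym (cw-⊕-< f<n u⊕f≡v)) arc)
    where
    f<n : f < n
    f<n = ≤-<-trans (proj₂ arc) (∸-monoʳ-< 1≤d d≤n)

m≤n⇒n+m≤3o⇒m≤n%o+o : ∀ {m n o} .{{_ : NonZero o}} → m ≤ n → n + m ≤ 3 * o → m ≤ n % o + o
m≤n⇒n+m≤3o⇒m≤n%o+o {m} {n} {o} m≤n n+m≤3o with n / o | m≡m%n+[m/n]*n n o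
... | 0 | n≡ = ≤-trans m≤n (≤-trans (≤-reflexive (trans n≡ (+-identityʳ _))) (m≤m+n _ o))
... | 1 | n≡ = ≤-trans m≤n (≤-reflexive (trans n≡ (cong (n % o +_) (+-identityʳ o))))
... | suc (suc q) | n≡ = ≤-trans (+-cancelʳ-≤ (o + o) m o m+2o≤3o) (m≤n+m o (n % o))
  where
  open ≤-Reasoning
  2o≤n : o + o ≤ n
  2o≤n = begin
    o + o                    ≤⟨ +-monoʳ-≤ o (m≤m+n o (q * o)) ⟩
    o + (o + q * o)          ≤⟨ m≤n+m _ (n % o) ⟩
    n % o + (o + (o + q * o)) ≡⟨ n≡ ⟨
    n                        ∎
  m+2o≤3o : m + (o + o) ≤ o + (o + o)
  m+2o≤3o = begin
    m + (o + o)  ≡⟨ +-comm m (o + o) ⟩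
    o + o + m    ≤⟨ +-monoˡ-≤ m 2o≤n ⟩
    n + m        ≤⟨ n+m≤3o ⟩
    3 * o        ≡⟨ cong (λ x → o + (o + x)) (+-identityʳ o) ⟩
    o + (o + o)  ∎

module _ {n : ℕ} .{{_ : NonZero n}} where

  threeArcs⇒3d≤cw+n : ∀ {d} {u x y v : Fin n} → d ≤ n →
    Arc n d (cw u x) → Arc n d (cw x y) → Arc n d (cw y v) → 3 * d ≤ cw u v + n
  threeArcs⇒3d≤cw+n {d} {u} {x} {y} {v} d≤n a₁ a₂ a₃ =
    subst (λ r → 3 * d ≤ r + n) (sym (cw-⊕ S u⊕S≡v)) (m≤n⇒n+m≤3o⇒m≤n%o+o 3d≤S S+3d≤3n)
    where
    open ≡-Reasoning
    f₁ f₂ f₃ S : ℕ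
    f₁ = cw u x
    f₂ = cw x y
    f₃ = cw y v
    S = f₁ + f₂ + f₃
    u⊕S≡v : u ⊕ S ≡ v
    u⊕S≡v = begin
      u ⊕ (f₁ + f₂ + f₃)  ≡⟨ ⊕-assoc u (f₁ + f₂) f₃ ⟨
      u ⊕ (f₁ + f₂) ⊕ f₃  ≡⟨ cong (_⊕ f₃) (⊕-assoc u f₁ f₂) ⟨
      u ⊕ f₁ ⊕ f₂ ⊕ f₃    ≡⟨ cong (λ w → w ⊕ f₂ ⊕ f₃) (⊕-cw u x) ⟩
      x ⊕ f₂ ⊕ f₃         ≡⟨ cong (_⊕ f₃) (⊕-cw x y) ⟩
      y ⊕ f₃              ≡⟨ ⊕-cw y v ⟩
      v                   ∎
    3d≤S : 3 * d ≤ S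
    3d≤S = subst (_≤ S) (triple d) (+-mono-≤ (+-mono-≤ (proj₁ a₁) (proj₁ a₂)) (proj₁ a₃))
      where
      triple : ∀ d → d + d + d ≡ 3 * d
      triple = solve-∀
    S+3d≤3n : S + 3 * d ≤ 3 * n
    S+3d≤3n = subst₂ _≤_ (regroup f₁ f₂ f₃ d) (regroup 0 0 0 n)
      (+-mono-≤ (+-mono-≤ (Arc⇒+≤ d≤n a₁) (Arc⇒+≤ d≤n a₂)) (Arc⇒+≤ d≤n a₃))
      where
      regroup : ∀ a b c d → a + d + (b + d) + (c + d) ≡ a + b + c + 3 * d
      regroup = solve-∀

linearPacking : ∀ {m n g} .{{_ : NonZero g}} (p : Fin m → ℕ) →
  (∀ i → p i + g ≤ n) → (∀ i j → i ≢ j → p i ≤ p j → p i + g ≤ p j) → m * g ≤ n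
linearPacking {m} {n} {g} p p+g≤n p-separated = begin
  m * g      ≤⟨ *-monoˡ-≤ g (injective⇒≤ slot-injective) ⟩
  n / g * g  ≤⟨ m/n*n≤m n g ⟩
  n          ∎
  where
  open ≤-Reasoning
  [m+g]/g≡1+m/g : ∀ a → (a + g) / g ≡ suc (a / g)
  [m+g]/g≡1+m/g a = trans (m/n≡1+[m∸n]/n (m≤n+m g a)) (cong (λ x → suc (x / g)) (m+n∸n≡m a g))
  slot-< : ∀ {a b} → a + g ≤ b → a / g < b / g
  slot-< {a} a+g≤b = subst (_≤ _) ([m+g]/g≡1+m/g a) (/-monoˡ-≤ g a+g≤b)
  slot : Fin m → Fin (n / g)
  slot i = fromℕ< (slot-< (p+g≤n i))
  slot-≡ : ∀ {i j} → slot i ≡ slot j → p i / g ≡ p j / g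
  slot-≡ {i} {j} eq =
    trans (sym (toℕ-fromℕ< (slot-< (p+g≤n i)))) (trans (cong toℕ eq) (toℕ-fromℕ< (slot-< (p+g≤n j))))
  slot-injective : Injective _≡_ _≡_ slot
  slot-injective {i} {j} eq with i ≟ j | ≤-total (p i) (p j)
  ... | yes i≡j | _          = i≡j
  ... | no i≢j  | inj₁ pᵢ≤pⱼ = contradiction (slot-≡ eq) (<⇒≢ (slot-< (p-separated i j i≢j pᵢ≤pⱼ)))
  ... | no i≢j  | inj₂ pⱼ≤pᵢ =
        contradiction (slot-≡ (sym eq)) (<⇒≢ (slot-< (p-separated j i (≢-sym i≢j) pⱼ≤pᵢ)))

module _ {n : ℕ} .{{_ : NonZero n}} where

  circularPacking : ∀ {m g} (x : Fin m → Fin n) → g ≤ n →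
    (∀ i j → i ≢ j → g ≤ cw (x i) (x j)) → m * g ≤ n
  circularPacking {zero} _ _ _ = z≤n
  circularPacking {suc m} {zero} _ _ _ = subst (_≤ n) (sym (*-zeroʳ (suc m))) z≤n
  circularPacking {suc m} {g@(suc _)} x g≤n x-separated = linearPacking p p+g≤n p-separated
    where
    x₀ : Fin n
    x₀ = x Fin.zero
    p : Fin (suc m) → ℕ
    p i = cw x₀ (x i)
    p+g≤n : ∀ i → p i + g ≤ n
    p+g≤n i with i ≟ Fin.zero
    ... | yes refl = subst (λ r → r + g ≤ n) (sym (cw-self x₀)) g≤n
    ... | no i≢0   = subst (p i + g ≤_) (cw+cw≡n x₀≢xᵢ) (+-monoʳ-≤ (p i) (x-separated i Fin.zero i≢0))
      where
      x₀≢xᵢ : x₀ ≢ x i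
      x₀≢xᵢ x₀≡xᵢ = <⇒≱ z<s (subst (g ≤_) (trans (cong (cw x₀) (sym x₀≡xᵢ)) (cw-self x₀))
                                          (x-separated Fin.zero i (≢-sym i≢0)))
    p-separated : ∀ i j → i ≢ j → p i ≤ p j → p i + g ≤ p j
    p-separated i j i≢j pᵢ≤pⱼ with cw-+ x₀ (x i) (x j)
    ... | inj₁ eq = subst (p i + g ≤_) eq (+-monoʳ-≤ (p i) (x-separated i j i≢j))
    ... | inj₂ eq = contradiction eq (<⇒≢ (+-mono-≤-< pᵢ≤pⱼ (cw<n (x i) (x j))))

CircAdj-sym : ∀ {n d} {u v : Fin n} → CircAdj n d u v → CircAdj n d v u
CircAdj-sym {u = u} {v} = subst (Arc _ _) (∣-∣-comm (toℕ u) (toℕ v))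

circAdj? : ∀ n d (u v : Fin n) → Dec (CircAdj n d u v)
circAdj? n d u v = (d ≤? ∣ toℕ u - toℕ v ∣) ×-dec (∣ toℕ u - toℕ v ∣ ≤? n ∸ d)

Hom : Graph → Graph → Set
Hom G G′ = Σ (Fin (size G) → Fin (size G′)) λ φ → ∀ u v → Adj G u v → Adj G′ (φ u) (φ v)

CircHom-∘ : ∀ {G G′ n d} → Hom G G′ → CircHom G′ n d → CircHom G n d
CircHom-∘ (φ , φ-adj) (c , c-adj) = c ∘ φ , λ u v uv → c-adj (φ u) (φ v) (φ-adj u v uv)

SubgraphOf⇒Hom : ∀ {H G} → SubgraphOf H G → Hom H G
SubgraphOf⇒Hom (f , _ , f-adj) = f , f-adj

SameEdge : {A : Set} → A → A → A → A → Set
SameEdge u v p q = (u ≡ p × v ≡ q) ⊎ (u ≡ q × v ≡ p)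

SameEdge-swap : ∀ {A : Set} {u v p q : A} → SameEdge u v p q → SameEdge v u p q
SameEdge-swap (inj₁ (u≡p , v≡q)) = inj₂ (v≡q , u≡p)
SameEdge-swap (inj₂ (u≡q , v≡p)) = inj₁ (v≡p , u≡q)

infixl 5 _─_
_─_ : (G : Graph) → Fin (size G) × Fin (size G) → Graph
G ─ (p , q) = record
  { size = size G
  ; Adj  = λ u v → Adj G u v × ¬ SameEdge u v p q
  ; sym  = λ (uv , ¬same) → Graph.sym G uv , ¬same ∘ SameEdge-swap
  ; irr  = λ (uu , _) → Graph.irr G uu
  }

EdgeImage : (H G : Graph) → (Fin (size H) → Fin (size G)) → Fin (size G) → Fin (size G) → Set
EdgeImage H G f p q = ∃₂ λ u v → f u ≡ p × f v ≡ q × Adj H u v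

SubgraphOf-─ : ∀ {H G p q} (sub : SubgraphOf H G) → ¬ EdgeImage H G (proj₁ sub) p q →
  SubgraphOf H (G ─ (p , q))
SubgraphOf-─ {H} (f , f-inj , f-adj) ¬image = f , f-inj , λ u v uv → f-adj u v uv , avoids u v uv
  where
  avoids : ∀ u v → Adj H u v → ¬ SameEdge (f u) (f v) _ _
  avoids u v uv (inj₁ (fu≡p , fv≡q)) = ¬image (u , v , fu≡p , fv≡q , uv)
  avoids u v uv (inj₂ (fu≡q , fv≡p)) = ¬image (v , u , fv≡p , fu≡q , Graph.sym H uv)

-- ¬¬-coverage suffices because both "f u ≡ p" and CircAdj are decidable.
CircHom-ofCover : ∀ {H G n d} (sub : SubgraphOf H G) → (∀ p → ∃ (Adj G p)) →
  (∀ p q → Adj G p q → ¬ ¬ EdgeImage H G (proj₁ sub) p q) → CircHom H n d → CircHom G n d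
CircHom-ofCover {H} {G} {n} {d} (f , f-inj , _) no-isolated covered (c , c-adj) = c ∘ f⁻¹ , c∘f⁻¹-adj
  where
  hit : ∀ p → ∃ λ u → f u ≡ p
  hit p = decidable-stable (any? λ u → f u ≟ p)
    λ ¬hit → covered p _ (proj₂ (no-isolated p)) λ (u , _ , fu≡p , _) → ¬hit (u , fu≡p)
  f⁻¹ : Fin (size G) → Fin (size H)
  f⁻¹ p = proj₁ (hit p)
  f⁻¹-unique : ∀ {u p} → f u ≡ p → u ≡ f⁻¹ p
  f⁻¹-unique {p = p} fu≡p = f-inj (trans fu≡p (sym (proj₂ (hit p))))
  c∘f⁻¹-adj : ∀ p q → Adj G p q → CircAdj n d (c (f⁻¹ p)) (c (f⁻¹ q))
  c∘f⁻¹-adj p q pq = decidable-stable (circAdj? n d (c (f⁻¹ p)) (c (f⁻¹ q))) λ ¬adj → covered p q pq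
    λ (u , v , fu≡p , fv≡q , uv) → ¬adj
      (subst₂ (λ u v → CircAdj n d (c u) (c v)) (f⁻¹-unique fu≡p) (f⁻¹-unique fv≡q) (c-adj u v uv))

Pair : ℕ → Set
Pair m = Fin m × Fin m

-- K_m with each edge ij replaced by the path (i , i) – (i , j) – (j , i) – (j , j).
data Link {m : ℕ} : Pair m → Pair m → Set where
  leg  : ∀ {i j} → i ≢ j → Link (i , i) (i , j)
  leg˘ : ∀ {i j} → i ≢ j → Link (i , j) (i , i)
  mid  : ∀ {i j} → i ≢ j → Link (i , j) (j , i)

Link-sym : ∀ {m} {P Q : Pair m} → Link P Q → Link Q P
Link-sym (leg i≢j)  = leg˘ i≢j
Link-sym (leg˘ i≢j) = leg i≢j
Link-sym (mid i≢j)  = mid (≢-sym i≢j)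

Link-irr : ∀ {m} {P : Pair m} → ¬ Link P P
Link-irr (leg i≢i)  = i≢i refl
Link-irr (leg˘ i≢i) = i≢i refl
Link-irr (mid i≢i)  = i≢i refl

pair : ∀ m → Fin (m * m) → Pair m
pair m = Fin.remQuot m

vertex : ∀ {m} → Pair m → Fin (m * m)
vertex = uncurry Fin.combine

pair-vertex : ∀ {m} (P : Pair m) → pair m (vertex P) ≡ P
pair-vertex (i , j) = remQuot-combine i j

pair-injective : ∀ {m} → Injective _≡_ _≡_ (pair m)
pair-injective {m} {u} {v} eq =
  trans (sym (combine-remQuot {m} m u)) (trans (cong vertex eq) (combine-remQuot {m} m v))

subdividedK : ℕ → Graph
subdividedK m = record
  { size = m * m
  ; Adj  = λ u v → Link (pair m u) (pair m v)
  ; sym  = Link-sym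
  ; irr  = Link-irr
  }

Link⇒Adj : ∀ {m} {P Q : Pair m} → Link P Q → Adj (subdividedK m) (vertex P) (vertex Q)
Link⇒Adj {P = P} {Q} = subst₂ Link (sym (pair-vertex P)) (sym (pair-vertex Q))

Hom-intoPairs : ∀ {G m} (ψ : Fin (size G) → Pair m) → (∀ u v → Adj G u v → Link (ψ u) (ψ v)) →
  Hom G (subdividedK m)
Hom-intoPairs ψ ψ-link = vertex ∘ ψ , λ u v uv → Link⇒Adj (ψ-link u v uv)

CircHom-ofPairs : ∀ {m n d} (c : Pair m → Fin n) → (∀ {P Q} → Link P Q → CircAdj n d (c P) (c Q)) →
  CircHom (subdividedK m) n d
CircHom-ofPairs {m} c c-link = c ∘ pair m , λ _ _ → c-link

other : ∀ {m} → 2 ≤ m → (i : Fin m) → ∃ (i ≢_)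
other {suc zero} (s≤s ()) _
other {suc (suc _)} _ i = Fin.punchIn i Fin.zero , ≢-sym (punchInᵢ≢i i Fin.zero)

Link-noIsolated : ∀ {m} → 2 ≤ m → (P : Pair m) → ∃ (Link P)
Link-noIsolated 2≤m (i , j) with i ≟ j
... | yes refl = (i , proj₁ (other 2≤m i)) , leg (proj₂ (other 2≤m i))
... | no i≢j   = (i , i) , leg˘ i≢j

subdividedK-noIsolated : ∀ {m} → 2 ≤ m → ∀ p → ∃ (Adj (subdividedK m) p)
subdividedK-noIsolated {m} 2≤m p =
  let (Q , PQ) = Link-noIsolated 2≤m (pair m p)
  in vertex Q , subst (Link (pair m p)) (sym (pair-vertex Q)) PQ

-- In the path between branch vertices i and j the colour advances clockwise three times by at
-- least d, so the branch colours are (3d − n)-separated on the cycle of length n.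
subdividedK-lowerBound : ∀ {m n d} → Admissible n d → CircHom (subdividedK m) n d → 3 * m * d ≤ n * suc m
subdividedK-lowerBound {m} {n} {d} (1≤d , 2d≤n) (c , c-adj) = begin
  3 * m * d                  ≡⟨ reorder m d ⟩
  m * (3 * d)                ≤⟨ *-monoʳ-≤ m (m≤n+m∸n (3 * d) n) ⟩
  m * (n + (3 * d ∸ n))      ≡⟨ *-distribˡ-+ m n (3 * d ∸ n) ⟩
  m * n + m * (3 * d ∸ n)    ≤⟨ +-monoʳ-≤ (m * n) packed ⟩
  m * n + n                  ≡⟨ collect m n ⟩
  n * suc m                  ∎
  where
  open ≤-Reasoning
  d≤n : d ≤ n
  d≤n = ≤-trans (m≤m+n d d) 2d≤n
  instance
    n-nonZero : NonZero n
    n-nonZero = >-nonZero (≤-trans 1≤d d≤n)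
  arc : ∀ {P Q} → Link P Q → Arc n d (cw (c (vertex P)) (c (vertex Q)))
  arc PQ = CircAdj⇒Arc-cw d≤n (c-adj _ _ (Link⇒Adj PQ))
  branch : Fin m → Fin n
  branch i = c (vertex (i , i))
  separated : ∀ i j → i ≢ j → 3 * d ∸ n ≤ cw (branch i) (branch j)
  separated i j i≢j = m≤n+o⇒m∸n≤o (3 * d) n (subst (3 * d ≤_) (+-comm _ n)
    (threeArcs⇒3d≤cw+n d≤n (arc (leg i≢j)) (arc (mid i≢j)) (arc (leg˘ (≢-sym i≢j)))))
  3d∸n≤n : 3 * d ∸ n ≤ n
  3d∸n≤n = m≤n+o⇒m∸n≤o (3 * d) n (subst (_≤ n + n) (cong (d +_) (cong (d +_) (sym (+-identityʳ d))))
    (+-mono-≤ d≤n 2d≤n))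
  packed : m * (3 * d ∸ n) ≤ n
  packed = circularPacking branch 3d∸n≤n separated
  reorder : ∀ m d → 3 * m * d ≡ m * (3 * d)
  reorder = solve-∀
  collect : ∀ m n → m * n + n ≡ n * suc m
  collect = solve-∀

Admissible-3m/[1+m] : ∀ {m} → 2 ≤ m → Admissible (3 * m) (suc m)
Admissible-3m/[1+m] {m} 2≤m = s≤s z≤n ,
  subst₂ _≤_ (cong suc (sym (+-suc m m))) (cong (λ x → m + (m + x)) (sym (+-identityʳ m)))
    (+-monoˡ-≤ (m + m) 2≤m)

-- Branch vertex x gets colour 3x and the inner vertex (x , y) the colour 3x + M + cw x y,
-- on the cycle of length 3M; both steps out of (x , y) are then M + cw x y.
module Colouring {M : ℕ} (2≤M : 2 ≤ M) where

  private
    1≤M : 1 ≤ M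
    1≤M = ≤-trans (s≤s z≤n) 2≤M

    instance
      M-nonZero : NonZero M
      M-nonZero = >-nonZero 1≤M
      3M-nonZero : NonZero (3 * M)
      3M-nonZero = >-nonZero (≤-trans 1≤M (m≤n*m M 3))

    M+1≤3M : suc M ≤ 3 * M
    M+1≤3M = ≤-trans (m≤m+n (suc M) (suc M)) (proj₂ (Admissible-3m/[1+m] 2≤M))

  colour : Pair M → Fin (3 * M)
  colour (x , y) with x ≟ y
  ... | yes _ = [ 3 * toℕ x ]
  ... | no _  = [ 3 * toℕ x + (M + cw x y) ]

  colour-diag : ∀ x → colour (x , x) ≡ [ 3 * toℕ x ]
  colour-diag x with x ≟ x
  ... | yes _  = refl
  ... | no x≢x = contradiction refl x≢x

  colour-off : ∀ {x y} → x ≢ y → colour (x , y) ≡ [ 3 * toℕ x + (M + cw x y) ]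
  colour-off {x} {y} x≢y with x ≟ y
  ... | yes x≡y = contradiction x≡y x≢y
  ... | no _    = refl

  step-arc : ∀ {x y : Fin M} → x ≢ y → Arc (3 * M) (suc M) (M + cw x y)
  step-arc {x} {y} x≢y = subst (_≤ M + t) (+-comm M 1) (+-monoʳ-≤ M 1≤t) ,
    m+n≤o⇒m≤o∸n (M + t) (subst₂ _≤_ (sym (regroup M t)) (triple M) (+-monoʳ-≤ (M + M) (cw<n x y)))
    where
    t = cw x y
    1≤t : 1 ≤ t
    1≤t = n≢0⇒n>0 (x≢y ∘ cw≡0⇒≡)
    regroup : ∀ M t → M + t + suc M ≡ M + M + suc t
    regroup = solve-∀
    triple : ∀ M → M + M + M ≡ 3 * M
    triple = solve-∀

  colour-leg : ∀ {x y} → x ≢ y → colour (x , x) ⊕ (M + cw x y) ≡ colour (x , y)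
  colour-leg {x} {y} x≢y = begin
    colour (x , x) ⊕ (M + cw x y)           ≡⟨ cong (_⊕ (M + cw x y)) (colour-diag x) ⟩
    [ 3 * toℕ x ] ⊕ (M + cw x y)            ≡⟨ [m]⊕f≡[m+f] (3 * toℕ x) (M + cw x y) ⟩
    [ 3 * toℕ x + (M + cw x y) ]            ≡⟨ colour-off x≢y ⟨
    colour (x , y)                          ∎
    where open ≡-Reasoning

  colour-mid : ∀ {x y} → x ≢ y → colour (x , y) ⊕ (M + cw x y) ≡ colour (y , x)
  colour-mid {x} {y} x≢y = begin
    colour (x , y) ⊕ (M + t)                   ≡⟨ cong (_⊕ (M + t)) (colour-off x≢y) ⟩
    [ 3 * toℕ x + (M + t) ] ⊕ (M + t)          ≡⟨ [m]⊕f≡[m+f] (3 * toℕ x + (M + t)) (M + t) ⟩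
    [ 3 * toℕ x + (M + t) + (M + t) ]          ≡⟨ cong [_] (regroup₂ (3 * toℕ x + (M + t)) t M) ⟨
    [ 3 * toℕ x + (M + t) + t + M ]            ≡⟨ cong (λ z → [ 3 * toℕ x + (M + t) + t + z ]) (cw+cw≡n x≢y) ⟨
    [ 3 * toℕ x + (M + t) + t + (t + t′) ]     ≡⟨ cong [_] (regroup₁ (toℕ x) t t′ M) ⟨
    [ 3 * (toℕ x + t) + (M + t′) ]             ≡⟨ [m]⊕f≡[m+f] (3 * (toℕ x + t)) (M + t′) ⟨
    [ 3 * (toℕ x + t) ] ⊕ (M + t′)             ≡⟨ cong (_⊕ (M + t′)) [3[x+t]]≡[3y] ⟩
    [ 3 * toℕ y ] ⊕ (M + t′)                   ≡⟨ [m]⊕f≡[m+f] (3 * toℕ y) (M + t′) ⟩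
    [ 3 * toℕ y + (M + t′) ]                   ≡⟨ colour-off (≢-sym x≢y) ⟨
    colour (y , x)                             ∎
    where
    open ≡-Reasoning
    t = cw x y
    t′ = cw y x
    regroup₁ : ∀ x t t′ M → 3 * (x + t) + (M + t′) ≡ 3 * x + (M + t) + t + (t + t′)
    regroup₁ = solve-∀
    regroup₂ : ∀ a t M → a + t + M ≡ a + (M + t)
    regroup₂ = solve-∀
    [3[x+t]]≡[3y] : _≡_ {A = Fin (3 * M)} [ 3 * (toℕ x + t) ] [ 3 * toℕ y ]
    [3[x+t]]≡[3y] = begin
      [ 3 * (toℕ x + t) ]        ≡⟨ [k*[m%n]]≡[k*m] 3 (toℕ x + t) ⟨
      [ 3 * ((toℕ x + t) % M) ]  ≡⟨ cong (λ z → [ 3 * z ]) (toℕ-fromℕ< (m%n<n _ M)) ⟨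
      [ 3 * toℕ (x ⊕ t) ]        ≡⟨ cong (λ z → [ 3 * toℕ z ]) (⊕-cw x y) ⟩
      [ 3 * toℕ y ]              ∎

  colour-link : ∀ {P Q} → Link P Q → CircAdj (3 * M) (suc M) (colour P) (colour Q)
  colour-link (leg {x} x≢y) = ⊕-Arc⇒CircAdj {u = colour (x , x)} (s≤s z≤n) M+1≤3M (step-arc x≢y) (colour-leg x≢y)
  colour-link (leg˘ {x} {y} x≢y) = CircAdj-sym {3 * M} {suc M} {colour (x , x)} (colour-link (leg x≢y))
  colour-link (mid {x} {y} x≢y) = ⊕-Arc⇒CircAdj {u = colour (x , y)} (s≤s z≤n) M+1≤3M (step-arc x≢y) (colour-mid x≢y)

CircHom-subdividedK : ∀ {M} → 2 ≤ M → CircHom (subdividedK M) (3 * M) (suc M)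
CircHom-subdividedK 2≤M = CircHom-ofPairs colour colour-link
  where open Colouring 2≤M

-- Deleting an edge of the path between a and b in subdividedK (1 + M) leaves a graph that maps
-- to subdividedK M: merge a with b, and fold what is left of their path onto a path of length
-- at most 2 hanging from the merged branch vertex.
module Merge {M : ℕ} (2≤M : 2 ≤ M) {a b : Fin (suc M)} (a≢b : a ≢ b) where

  κ′ : ∀ i → Dec (i ≡ b) → Fin M
  κ′ i (yes _)  = Fin.punchOut (≢-sym a≢b)
  κ′ i (no i≢b) = Fin.punchOut (≢-sym i≢b)

  κ : Fin (suc M) → Fin M
  κ i = κ′ i (i ≟ b)

  κa≡κb : κ a ≡ κ b
  κa≡κb with a ≟ b | b ≟ b
  ... | yes a≡b | _      = contradiction a≡b a≢b
  ... | no _    | yes _  = punchOut-cong b refl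
  ... | no _    | no b≢b = contradiction refl b≢b

  κ-merges : ∀ {i j} → κ i ≡ κ j → i ≡ j ⊎ SameEdge i j a b
  κ-merges {i} {j} with i ≟ b | j ≟ b
  ... | yes i≡b | yes j≡b = λ _ → inj₁ (trans i≡b (sym j≡b))
  ... | yes i≡b | no j≢b  = λ eq → inj₂ (inj₂ (i≡b , sym (punchOut-injective (≢-sym a≢b) (≢-sym j≢b) eq)))
  ... | no i≢b  | yes j≡b = λ eq → inj₂ (inj₁ (punchOut-injective (≢-sym i≢b) (≢-sym a≢b) eq , j≡b))
  ... | no i≢b  | no j≢b  = λ eq → inj₁ (punchOut-injective (≢-sym i≢b) (≢-sym j≢b) eq)

  φ′ : (Fin (suc M) → Pair M) → ∀ i j → Dec (i ≡ j) → Dec (κ i ≡ κ j) → Pair M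
  φ′ σ i j (yes _) _       = κ i , κ i
  φ′ σ i j (no _)  (no _)  = κ i , κ j
  φ′ σ i j (no _)  (yes _) = σ i

  -- σ a and σ b are the images of (a , b) and (b , a)
  φ : (Fin (suc M) → Pair M) → Pair (suc M) → Pair M
  φ σ (i , j) = φ′ σ i j (i ≟ j) (κ i ≟ κ j)

  module _ (σ : Fin (suc M) → Pair M) where

    φ-diag : ∀ i → φ σ (i , i) ≡ (κ i , κ i)
    φ-diag i with i ≟ i
    ... | yes _   = refl
    ... | no i≢i = contradiction refl i≢i

    φ-off : ∀ {i j} → i ≢ j → κ i ≢ κ j → φ σ (i , j) ≡ (κ i , κ j)
    φ-off {i} {j} i≢j κi≢κj with i ≟ j | κ i ≟ κ j
    ... | yes i≡j | _         = contradiction i≡j i≢j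
    ... | no _    | yes κi≡κj = contradiction κi≡κj κi≢κj
    ... | no _    | no _      = refl

    φ-merged : ∀ {i j} → i ≢ j → κ i ≡ κ j → φ σ (i , j) ≡ σ i
    φ-merged {i} {j} i≢j κi≡κj with i ≟ j | κ i ≟ κ j
    ... | yes i≡j | _          = contradiction i≡j i≢j
    ... | no _    | no κi≢κj   = contradiction κi≡κj κi≢κj
    ... | no _    | yes _      = refl

    module _ {P₀ Q₀ : Pair (suc M)}
      (link-a  : SameEdge (a , a) (a , b) P₀ Q₀ ⊎ Link (κ a , κ a) (σ a))
      (link-b  : SameEdge (b , b) (b , a) P₀ Q₀ ⊎ Link (κ b , κ b) (σ b))
      (link-ab : SameEdge (a , b) (b , a) P₀ Q₀ ⊎ Link (σ a) (σ b)) where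

      private
        unlessDeleted : ∀ {P Q : Pair (suc M)} {P′ Q′ : Pair M} →
          SameEdge P Q P₀ Q₀ ⊎ Link P′ Q′ → ¬ SameEdge P Q P₀ Q₀ → Link P′ Q′
        unlessDeleted (inj₁ deleted) kept = contradiction deleted kept
        unlessDeleted (inj₂ l)       _    = l

      φ-Link : ∀ {P Q} → Link P Q → ¬ SameEdge P Q P₀ Q₀ → Link (φ σ P) (φ σ Q)
      φ-Link (leg {i} {j} i≢j) kept with toSum (κ i ≟ κ j)
      ... | inj₂ κi≢κj = subst₂ Link (sym (φ-diag i)) (sym (φ-off i≢j κi≢κj)) (leg κi≢κj)
      ... | inj₁ κi≡κj with κ-merges κi≡κj
      ...   | inj₁ i≡j                  = contradiction i≡j i≢j
      ...   | inj₂ (inj₁ (refl , refl)) =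
              subst₂ Link (sym (φ-diag a)) (sym (φ-merged i≢j κi≡κj)) (unlessDeleted link-a kept)
      ...   | inj₂ (inj₂ (refl , refl)) =
              subst₂ Link (sym (φ-diag b)) (sym (φ-merged i≢j κi≡κj)) (unlessDeleted link-b kept)
      φ-Link (leg˘ i≢j) kept = Link-sym (φ-Link (leg i≢j) (kept ∘ SameEdge-swap))
      φ-Link (mid {i} {j} i≢j) kept with toSum (κ i ≟ κ j)
      ... | inj₂ κi≢κj =
            subst₂ Link (sym (φ-off i≢j κi≢κj)) (sym (φ-off (≢-sym i≢j) (≢-sym κi≢κj))) (mid κi≢κj)
      ... | inj₁ κi≡κj with κ-merges κi≡κj
      ...   | inj₁ i≡j                  = contradiction i≡j i≢j
      ...   | inj₂ (inj₁ (refl , refl)) = subst₂ Link (sym (φ-merged i≢j κi≡κj))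
              (sym (φ-merged (≢-sym i≢j) (sym κi≡κj))) (unlessDeleted link-ab kept)
      ...   | inj₂ (inj₂ (refl , refl)) = subst₂ Link (sym (φ-merged i≢j κi≡κj))
              (sym (φ-merged (≢-sym i≢j) (sym κi≡κj))) (Link-sym (unlessDeleted link-ab (kept ∘ SameEdge-swap)))

  x : Fin M
  x = κ a

  y : Fin M
  y = proj₁ (other 2≤M x)

  x≢y : x ≢ y
  x≢y = proj₂ (other 2≤M x)

  σ-leg′ : ∀ i → Dec (i ≡ a) → Pair M
  σ-leg′ _ (yes _) = y , x
  σ-leg′ _ (no _)  = x , y

  σ-leg : Fin (suc M) → Pair M
  σ-leg i = σ-leg′ i (i ≟ a)

  σ-leg-a : σ-leg a ≡ (y , x)
  σ-leg-a with a ≟ a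
  ... | yes _   = refl
  ... | no a≢a = contradiction refl a≢a

  σ-leg-b : σ-leg b ≡ (x , y)
  σ-leg-b with b ≟ a
  ... | yes b≡a = contradiction (sym b≡a) a≢b
  ... | no _    = refl

  σ-mid : Fin (suc M) → Pair M
  σ-mid _ = x , y

  φ-Link-legDeleted : ∀ {P Q} → Link P Q → ¬ SameEdge P Q (a , a) (a , b) → Link (φ σ-leg P) (φ σ-leg Q)
  φ-Link-legDeleted = φ-Link σ-leg (inj₁ (inj₁ (refl , refl)))
    (inj₂ (subst₂ Link (cong (λ z → z , z) κa≡κb) (sym σ-leg-b) (leg x≢y)))
    (inj₂ (subst₂ Link (sym σ-leg-a) (sym σ-leg-b) (mid (≢-sym x≢y))))

  φ-Link-midDeleted : ∀ {P Q} → Link P Q → ¬ SameEdge P Q (a , b) (b , a) → Link (φ σ-mid P) (φ σ-mid Q)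
  φ-Link-midDeleted = φ-Link σ-mid (inj₂ (leg x≢y))
    (inj₂ (subst (λ z → Link (z , z) (x , y)) κa≡κb (leg x≢y))) (inj₁ (inj₁ (refl , refl)))

Link-─ : ∀ {M} → 2 ≤ M → ∀ {P₀ Q₀ : Pair (suc M)} → Link P₀ Q₀ →
  Σ (Pair (suc M) → Pair M) λ φ → ∀ {P Q} → Link P Q → ¬ SameEdge P Q P₀ Q₀ → Link (φ P) (φ Q)
Link-─ 2≤M (leg a≢b)  = _ , Merge.φ-Link-legDeleted 2≤M a≢b
Link-─ 2≤M (leg˘ a≢b) = _ , λ PQ kept → Merge.φ-Link-legDeleted 2≤M a≢b PQ (kept ∘ ⊎-swap)
Link-─ 2≤M (mid a≢b)  = _ , Merge.φ-Link-midDeleted 2≤M a≢b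

SameEdge-injective : ∀ {A B : Set} {f : A → B} → Injective _≡_ _≡_ f →
  ∀ {u v p q} → SameEdge (f u) (f v) (f p) (f q) → SameEdge u v p q
SameEdge-injective f-inj (inj₁ (fu≡fp , fv≡fq)) = inj₁ (f-inj fu≡fp , f-inj fv≡fq)
SameEdge-injective f-inj (inj₂ (fu≡fq , fv≡fp)) = inj₂ (f-inj fu≡fq , f-inj fv≡fp)

Hom-─ : ∀ {M} → 2 ≤ M → ∀ p q → Adj (subdividedK (suc M)) p q →
  Hom (subdividedK (suc M) ─ (p , q)) (subdividedK M)
Hom-─ {M} 2≤M p q pq =
  let (φ , φ-link) = Link-─ 2≤M pq
  in Hom-intoPairs {subdividedK (suc M) ─ (p , q)} (φ ∘ pair (suc M))
       λ u v (uv , kept) → φ-link uv (kept ∘ SameEdge-injective pair-injective)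

χc≡-intro : ∀ {G a b} → Admissible a b → CircHom G a b →
  (∀ n d → Admissible n d → CircHom G n d → a * d ≤ n * b) → χc≡ G a b
χc≡-intro adm hom lower = lower , λ _ _ _ a/b<s/t → _ , _ , adm , hom , a/b<s/t

χc-subdividedK : ∀ {m} → 2 ≤ m → χc≡ (subdividedK m) (3 * m) (suc m)
χc-subdividedK {m} 2≤m = χc≡-intro {subdividedK m} (Admissible-3m/[1+m] 2≤m) (CircHom-subdividedK 2≤m)
  (λ _ _ → subdividedK-lowerBound {m})

noSubgraph-between : ∀ {M H a b} → 2 ≤ M → SubgraphOf H (subdividedK (suc M)) →
  3 * M * b < a * suc M → a * suc (suc M) < 3 * suc M * b → ¬ χc≡ H a b
noSubgraph-between {M} {H} 2≤M sub 3M/[1+M]<a/b a/b<3[1+M]/[2+M] (χ-lower , χ-upper) =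
  let (n , d , adm , H→K , n/d<3[1+M]/[2+M]) = χ-upper (3 * suc M) (suc (suc M)) (s≤s z≤n) a/b<3[1+M]/[2+M]
      G→K = CircHom-ofCover {H} {G} sub (subdividedK-noIsolated (≤-trans 2≤M (n≤1+n M))) covered H→K
  in <⇒≱ n/d<3[1+M]/[2+M] (subdividedK-lowerBound {suc M} adm G→K)
  where
  G : Graph
  G = subdividedK (suc M)
  covered : ∀ p q → Adj G p q → ¬ ¬ EdgeImage H G (proj₁ sub) p q
  covered p q pq uncovered = <⇒≱ 3M/[1+M]<a/b (χ-lower (3 * M) (suc M) (Admissible-3m/[1+m] 2≤M) H→K)
    where
    H→K : CircHom H (3 * M) (suc M)
    H→K = CircHom-∘ {H} {G ─ (p , q)} (SubgraphOf⇒Hom {H} {G ─ (p , q)} (SubgraphOf-─ {H} {G} sub uncovered))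
            (CircHom-∘ {G ─ (p , q)} {subdividedK M} (Hom-─ 2≤M p q pq) (CircHom-subdividedK 2≤M))

corollary3 : (k : ℕ) → 1 ≤ k →
    Σ Graph λ G → χc≡ G (9 * k + 3) (3 * k + 2) ×
      ((H : Graph) → SubgraphOf H G → ¬ χc≡ H (6 * k + 1) (2 * k + 1))
corollary3 k 1≤k =
  G ,
  subst₂ (χc≡ G) (9k+3 k) (3k+2 k) (χc-subdividedK (≤-trans 2≤3k (n≤1+n _))) ,
  λ H sub → noSubgraph-between {H = H} {a = 6 * k + 1} {b = 2 * k + 1} 2≤3k sub
    (≤-reflexive (lower-gap k)) (≤-reflexive (upper-gap k))
  where
  G : Graph
  G = subdividedK (suc (3 * k))
  2≤3k : 2 ≤ 3 * k
  2≤3k = ≤-trans (s≤s (s≤s z≤n)) (*-monoʳ-≤ 3 1≤k)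
  9k+3 : ∀ k → 3 * suc (3 * k) ≡ 9 * k + 3
  9k+3 = solve-∀
  3k+2 : ∀ k → suc (suc (3 * k)) ≡ 3 * k + 2
  3k+2 = solve-∀
  lower-gap : ∀ k → suc (3 * (3 * k) * (2 * k + 1)) ≡ (6 * k + 1) * suc (3 * k)
  lower-gap = solve-∀
  upper-gap : ∀ k → suc ((6 * k + 1) * suc (suc (3 * k))) ≡ 3 * suc (3 * k) * (2 * k + 1)
  upper-gap = solve-∀
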